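{- Let $\{H_i: i\in[k]\}$ be a collection of induced subgraphs of a graph $G$ such that $|E(H_i)\cap E(H_j)|\leq 1$ for all $i\neq j$. Then \[\sum_{i=1}^{k}\deg(H_i)\leq\deg(G).\]
   Context: A 2-switch acting on a graph $X$ is given by distinct vertices $a,b,c,d$ with $ab,cd\in E(X)$, $ac,bd\notin E(X)$, and transforms $X$ into $(X-\{ab,cd\})+\{ac,bd\}$. The 2-switch-degree $\deg(X)$ is the number of distinct graphs obtainable from $X$ by a single 2-switch (each $H_i$ regarded as a graph on its own vertex set). -}

module Defs where

open import Data.Nat using (ℕ; _+_; _<ᵇ_)
open import Data.Bool using (Bool; true; false; _∧_; _∨_; not; if_then_else_)
import Data.Bool.Properties as BoolP
open import Data.Fin using (Fin; toℕ; _≟_)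
open import Data.Fin.Subset using (Subset)
open import Data.Vec using (Vec; tabulate; lookup)
import Data.Vec.Properties as VecP
open import Data.List using (List; []; _∷_; concatMap; map; filterᵇ; length; deduplicate; allFin)
open import Data.Nat.ListAction using (sum)
open import Data.Product using (_×_; _,_)
open import Relation.Nullary using (does)
open import Relation.Binary.PropositionalEquality using (_≡_)

record Graph (n : ℕ) : Set where
  field
    adj     : Fin n → Fin n → Bool
    sym     : ∀ u v → adj u v ≡ adj v u
    irrefl  : ∀ v → adj v v ≡ false
open Graph public

-- Adjacency relation as matrix; used to compare graphs on the same vertex set.
Adj : ℕ → Set
Adj n = Fin n → Fin n → Bool

toMatrix : ∀ {n} → Adj n → Vec (Vec Bool n) n
toMatrix A = tabulate λ u → tabulate λ v → A u v

_==_ : ∀ {n} → Fin n → Fin n → Bool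
u == v = does (u ≟ v)

samePair : ∀ {n} → Fin n → Fin n → Fin n → Fin n → Bool
samePair x y p q = (x == p ∧ y == q) ∨ (x == q ∧ y == p)

Quad : ℕ → Set
Quad n = Fin n × Fin n × Fin n × Fin n

allQuads : ∀ {n} → List (Quad n)
allQuads {n} =
  concatMap (λ a → concatMap (λ b → concatMap (λ c → map (λ d → (a , b , c , d))
    (allFin n)) (allFin n)) (allFin n)) (allFin n)

isSwitch : ∀ {n} → Subset n → Adj n → Quad n → Bool
isSwitch W A (a , b , c , d) =
  lookup W a ∧ lookup W b ∧ lookup W c ∧ lookup W d
  ∧ not (a == b) ∧ not (a == c) ∧ not (a == d)
  ∧ not (b == c) ∧ not (b == d) ∧ not (c == d)
  ∧ A a b ∧ A c d ∧ not (A a c) ∧ not (A b d)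

switch : ∀ {n} → Adj n → Quad n → Adj n
switch A (a , b , c , d) x y =
  if samePair x y a b ∨ samePair x y c d then false
  else if samePair x y a c ∨ samePair x y b d then true
  else A x y

-- 2-switch-degree of the graph with vertex set W ⊆ Fin n and adjacency A
-- (A is assumed to vanish outside W): number of distinct graphs obtained by
-- one 2-switch.
deg : ∀ {n} → Subset n → Adj n → ℕ
deg W A = length (deduplicate (VecP.≡-dec (VecP.≡-dec BoolP._≟_))
                    (map (λ q → toMatrix (switch A q)) (filterᵇ (isSwitch W A) allQuads)))

full : ∀ {n} → Subset n
full = tabulate λ _ → true

inducedAdj : ∀ {n} → Graph n → Subset n → Adj n
inducedAdj G S u v = lookup S u ∧ lookup S v ∧ adj G u v

degG : ∀ {n} → Graph n → ℕ
degG G = deg full (adj G)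

degInduced : ∀ {n} → Graph n → Subset n → ℕ
degInduced G S = deg S (inducedAdj G S)

commonEdges : ∀ {n} → Graph n → Subset n → Subset n → ℕ
commonEdges {n} G S T =
  length (filterᵇ (λ { (u , v) → (toℕ u <ᵇ toℕ v) ∧ inducedAdj G S u v ∧ inducedAdj G T u v })
    (concatMap (λ u → map (λ v → (u , v)) (allFin n)) (allFin n)))

sumFin : ∀ {k} → (Fin k → ℕ) → ℕ
sumFin {k} f = sum (map f (allFin k))

module Submission where

-- A 2-switch of an induced subgraph G[S] is a 2-switch of G, and what it produces is the
-- restriction to S of what the same switch produces on G; so deg(G[S]) is at most the
-- number of distinct graphs obtained from G by 2-switches inside S. Such a graph can
-- arise from switches inside both S and T only if the two edges it loses lie in both
-- G[S] and G[T]. So when G[S] and G[T] share at most one edge these sets of graphs are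
-- disjoint, and all of them are among the graphs counted by deg(G).

open import Defs hiding (sym)
open import Data.Bool using (Bool; true; false; _∧_; _∨_; not; T?)
import Data.Bool as Bool
open import Data.Bool.Properties using (T-≡; ∨-zeroʳ; not-injective)
open import Data.Nat using (ℕ; _≤_; _<_; _+_; z≤n; s≤s; _<ᵇ_)
import Data.Nat.Properties as ℕ
open import Data.Nat.ListAction using (sum)
open import Data.Fin using (Fin; _≟_; toℕ)
open import Data.Fin.Properties using (toℕ-injective)
open import Data.Fin.Subset using (Subset)
open import Data.Vec using (Vec; lookup; tabulate)
open import Data.Vec.Properties using (lookup∘tabulate; tabulate-cong; ≡-dec)
open import Data.List using (List; []; _∷_; concat; concatMap; map; filterᵇ; length; deduplicate; allFin)
open import Data.List.Properties using (length-++; length-map; length-removeAt′; map-∘; map-cong-local)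
open import Data.List.Membership.Propositional using (_∈_)
open import Data.List.Membership.Propositional.Properties
  using (∈-map⁺; ∈-map⁻; ∈-filter⁺; ∈-filter⁻; ∈-concatMap⁺; ∈-concatMap⁻; ∈-allFin; ∈-deduplicate⁺; ∈-deduplicate⁻)
open import Data.List.Relation.Unary.Any as Any using (here; there; _─_; satisfied)
open import Data.List.Relation.Unary.All as All using (All; []; _∷_)
import Data.List.Relation.Unary.All.Properties as All
open import Data.List.Relation.Unary.AllPairs as AllPairs using ([]; _∷_)
import Data.List.Relation.Unary.AllPairs.Properties as AllPairs
open import Data.List.Relation.Unary.Unique.Propositional using (Unique)
import Data.List.Relation.Unary.Unique.Propositional.Properties as Unique
import Data.List.Relation.Unary.Unique.DecPropositional.Properties as UniqueDec
open import Data.List.Relation.Binary.Disjoint.Propositional using (Disjoint)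
open import Data.Product using (_×_; _,_; proj₁; proj₂; ∃)
open import Data.Sum using (_⊎_; inj₁; inj₂; [_,_])
open import Function using (_∘_; Equivalence)
open import Relation.Nullary using (yes; no)
open import Relation.Nullary.Decidable using (dec-true)
open import Relation.Binary.Definitions using (DecidableEquality; tri<; tri≈; tri>)
open import Relation.Binary.PropositionalEquality
  using (_≡_; _≢_; refl; sym; trans; cong; subst; module ≡-Reasoning)

module _ {A : Set} where

  ∈-─ : ∀ {x z : A} {ys} → z ∈ ys → z ≢ x → (x∈ys : x ∈ ys) → z ∈ (ys ─ x∈ys)
  ∈-─ (here refl) z≢x (here refl) with () ← z≢x refl
  ∈-─ (there z∈ys) _ (here refl) = z∈ys
  ∈-─ (here refl) _ (there _) = here refl
  ∈-─ (there z∈ys) z≢x (there x∈ys) = there (∈-─ z∈ys z≢x x∈ys)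

  unique⊆⇒length≤ : ∀ {xs ys : List A} → Unique xs → (∀ {z} → z ∈ xs → z ∈ ys) → length xs ≤ length ys
  unique⊆⇒length≤ {[]} _ _ = z≤n
  unique⊆⇒length≤ {x ∷ xs} {ys} (x∉xs ∷ xs!) xs⊆ys =
    subst (length (x ∷ xs) ≤_) (sym (length-removeAt′ ys _))
      (s≤s (unique⊆⇒length≤ xs! λ z∈xs →
        ∈-─ (xs⊆ys (there z∈xs)) (λ z≡x → All.lookup x∉xs z∈xs (sym z≡x)) (xs⊆ys (here refl))))

  length-concat : ∀ (xss : List (List A)) → length (concat xss) ≡ sum (map length xss)
  length-concat [] = refl
  length-concat (xs ∷ xss) rewrite length-++ xs {concat xss} = cong (length xs +_) (length-concat xss)

  ∈-filterᵇ⁺ : ∀ (p : A → Bool) {x xs} → x ∈ xs → p x ≡ true → x ∈ filterᵇ p xs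
  ∈-filterᵇ⁺ p x∈xs px = ∈-filter⁺ (T? ∘ p) x∈xs (Equivalence.from T-≡ px)

  ∈-filterᵇ⁻ : ∀ (p : A → Bool) {x xs} → x ∈ filterᵇ p xs → x ∈ xs × p x ≡ true
  ∈-filterᵇ⁻ p {xs = xs} x∈ with ∈-filter⁻ (T? ∘ p) {xs = xs} x∈
  ... | x∈xs , Tpx = x∈xs , Equivalence.to T-≡ Tpx

  2≤length-filterᵇ : ∀ (p : A → Bool) {x y xs} → x ∈ xs → y ∈ xs → x ≢ y → p x ≡ true → p y ≡ true
                   → 2 ≤ length (filterᵇ p xs)
  2≤length-filterᵇ p x∈xs y∈xs x≢y px py =
    unique⊆⇒length≤ ((x≢y ∷ []) ∷ [] ∷ [])
      λ { (here refl) → ∈-filterᵇ⁺ p x∈xs px ; (there (here refl)) → ∈-filterᵇ⁺ p y∈xs py }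

length-deduplicate-map≤ : ∀ {A B : Set} (_≟ᴬ_ : DecidableEquality A) (_≟ᴮ_ : DecidableEquality B)
                          (f : A → B) (xs : List A)
                        → length (deduplicate _≟ᴮ_ (map f xs)) ≤ length (deduplicate _≟ᴬ_ xs)
length-deduplicate-map≤ _≟ᴬ_ _≟ᴮ_ f xs =
  ℕ.≤-trans (unique⊆⇒length≤ (UniqueDec.deduplicate-! _≟ᴮ_ (map f xs)) ⊆image)
            (ℕ.≤-reflexive (length-map f (deduplicate _≟ᴬ_ xs)))
  where
  ⊆image : ∀ {z} → z ∈ deduplicate _≟ᴮ_ (map f xs) → z ∈ map f (deduplicate _≟ᴬ_ xs)
  ⊆image z∈ with ∈-map⁻ f (∈-deduplicate⁻ _≟ᴮ_ (map f xs) z∈)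
  ... | x , x∈xs , refl = ∈-map⁺ f (∈-deduplicate⁺ _≟ᴬ_ x∈xs)

sum-map-mono-≤ : ∀ {A : Set} {f g : A → ℕ} → (∀ x → f x ≤ g x) → ∀ xs → sum (map f xs) ≤ sum (map g xs)
sum-map-mono-≤ f≤g [] = z≤n
sum-map-mono-≤ f≤g (x ∷ xs) = ℕ.+-mono-≤ (f≤g x) (sum-map-mono-≤ f≤g xs)

∧-true : ∀ {x y} → x ∧ y ≡ true → x ≡ true × y ≡ true
∧-true {true} y≡true = refl , y≡true

∨-true : ∀ {x y} → x ∨ y ≡ true → x ≡ true ⊎ y ≡ true
∨-true {true} _ = inj₁ refl
∨-true {false} y≡true = inj₂ y≡true

module _ {n : ℕ} where

  ==⇒≡ : {u v : Fin n} → u == v ≡ true → u ≡ v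
  ==⇒≡ {u} {v} _ with yes u≡v ← u ≟ v = u≡v

  not-==⇒≢ : {u v : Fin n} → not (u == v) ≡ true → u ≢ v
  not-==⇒≢ {u} {v} _ with no u≢v ← u ≟ v = u≢v

  samePair-refl : ∀ (x y : Fin n) → samePair x y x y ≡ true
  samePair-refl x y rewrite dec-true (x ≟ x) refl | dec-true (y ≟ y) refl = refl

  samePair⇒ : ∀ {x y p q : Fin n} → samePair x y p q ≡ true → (x ≡ p × y ≡ q) ⊎ (x ≡ q × y ≡ p)
  samePair⇒ {x} {y} {p} {q} same with ∨-true {x == p ∧ y == q} same
  ... | inj₁ straight = let x=p , y=q = ∧-true straight in inj₁ (==⇒≡ x=p , ==⇒≡ y=q)
  ... | inj₂ crossed  = let x=q , y=p = ∧-true crossed  in inj₂ (==⇒≡ x=q , ==⇒≡ y=p)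

  samePair-∈ : ∀ (P : Fin n → Set) {x y p q} → samePair x y p q ≡ true → P p → P q → P x × P y
  samePair-∈ P {x} {y} {p} {q} same Pp Pq with samePair⇒ {x} {y} {p} {q} same
  ... | inj₁ (refl , refl) = Pp , Pq
  ... | inj₂ (refl , refl) = Pq , Pp

  samePair₂-∈ : ∀ (P : Fin n → Set) {x y p q r s} → (samePair x y p q ∨ samePair x y r s) ≡ true
              → P p → P q → P r → P s → P x × P y
  samePair₂-∈ P {x} {y} {p} {q} same Pp Pq Pr Ps with ∨-true {samePair x y p q} same
  ... | inj₁ samePQ = samePair-∈ P samePQ Pp Pq
  ... | inj₂ sameRS = samePair-∈ P sameRS Pr Ps

module _ {n : ℕ} (A : Adj n) where

  switch-removes-ab : ∀ a b c d → switch A (a , b , c , d) a b ≡ false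
  switch-removes-ab a b c d rewrite samePair-refl a b = refl

  switch-removes-cd : ∀ a b c d → switch A (a , b , c , d) c d ≡ false
  switch-removes-cd a b c d rewrite samePair-refl c d | ∨-zeroʳ (samePair c d a b) = refl

  switch-lost-edge : ∀ {a b c d x y} → switch A (a , b , c , d) x y ≡ false → A x y ≡ true
                   → (samePair x y a b ∨ samePair x y c d) ≡ true
  switch-lost-edge {a} {b} {c} {d} {x} {y} lost edge
    with samePair x y a b ∨ samePair x y c d | samePair x y a c ∨ samePair x y b d
  ... | true  | _     = refl
  ... | false | true  with () ← lost
  ... | false | false with () ← trans (sym edge) lost

lookup-full : ∀ {n} (v : Fin n) → lookup full v ≡ true
lookup-full = lookup∘tabulate (λ _ → true)

restrict : ∀ {n} → Subset n → Adj n → Adj n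
restrict S A u v = lookup S u ∧ lookup S v ∧ A u v

module _ {n : ℕ} (S : Subset n) (A : Adj n) where

  _∈S : Fin n → Set
  v ∈S = lookup S v ≡ true

  switch-restrict : ∀ {a b c d} → a ∈S → b ∈S → c ∈S → d ∈S
                  → ∀ x y → switch (restrict S A) (a , b , c , d) x y ≡ restrict S (switch A (a , b , c , d)) x y
  switch-restrict {a} {b} {c} {d} Sa Sb Sc Sd x y
    with samePair x y a b ∨ samePair x y c d in removed | samePair x y a c ∨ samePair x y b d in added
  ... | true | _
    with Sx , Sy ← samePair₂-∈ _∈S {x} {y} removed Sa Sb Sc Sd rewrite Sx | Sy = refl
  ... | false | true
    with Sx , Sy ← samePair₂-∈ _∈S {x} {y} added Sa Sc Sb Sd rewrite Sx | Sy = refl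
  ... | false | false = refl

  isSwitch-restrict : ∀ q → isSwitch S (restrict S A) q ≡ true → isSwitch full A q ≡ true
  isSwitch-restrict (a , b , c , d) sw
    rewrite lookup-full a | lookup-full b | lookup-full c | lookup-full d
    with lookup S a | lookup S b | lookup S c | lookup S d
  ... | true | true | true | true = sw

module _ {I A : Set} (B : I → List A) where

  sum-length≤length-of-disjoint : ∀ {is ys} → Unique is → (∀ i → Unique (B i))
    → (∀ {i j} → i ≢ j → Disjoint (B i) (B j)) → (∀ {i z} → z ∈ B i → z ∈ ys)
    → sum (map (length ∘ B) is) ≤ length ys
  sum-length≤length-of-disjoint {is} {ys} is! B! B-disjoint B⊆ys = begin
    sum (map (length ∘ B) is)     ≡⟨ cong sum (map-∘ is) ⟩
    sum (map length (map B is))   ≡⟨ length-concat (map B is) ⟨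
    length (concatMap B is)       ≤⟨ unique⊆⇒length≤ concat! concat⊆ys ⟩
    length ys                     ∎
    where
    open ℕ.≤-Reasoning
    concat! : Unique (concatMap B is)
    concat! = Unique.concat⁺ (All.map⁺ (All.tabulate λ {i} _ → B! i)) (AllPairs.map⁺ (AllPairs.map B-disjoint is!))
    concat⊆ys : ∀ {z} → z ∈ concatMap B is → z ∈ ys
    concat⊆ys z∈ = let _ , z∈Bi = satisfied (∈-concatMap⁻ B {xs = is} z∈) in B⊆ys z∈Bi

record IsTwoSwitch {n} (W : Subset n) (A : Adj n) (a b c d : Fin n) : Set where
  field
    a∈W : lookup W a ≡ true
    b∈W : lookup W b ≡ true
    c∈W : lookup W c ≡ true
    d∈W : lookup W d ≡ true
    a≢b : a ≢ b
    a≢c : a ≢ c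
    a≢d : a ≢ d
    b≢c : b ≢ c
    b≢d : b ≢ d
    c≢d : c ≢ d
    ab∈E : A a b ≡ true
    cd∈E : A c d ≡ true
    ac∉E : A a c ≡ false
    bd∉E : A b d ≡ false

isSwitch-sound : ∀ {n} {W : Subset n} {A : Adj n} {a b c d}
               → isSwitch W A (a , b , c , d) ≡ true → IsTwoSwitch W A a b c d
isSwitch-sound sw =
  let a∈W , sw = ∧-true sw ; b∈W , sw = ∧-true sw ; c∈W , sw = ∧-true sw ; d∈W , sw = ∧-true sw
      a≠b , sw = ∧-true sw ; a≠c , sw = ∧-true sw ; a≠d , sw = ∧-true sw
      b≠c , sw = ∧-true sw ; b≠d , sw = ∧-true sw ; c≠d , sw = ∧-true sw
      ab∈E , sw = ∧-true sw ; cd∈E , sw = ∧-true sw ; ac∉E , bd∉E = ∧-true sw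
  in record
    { a∈W = a∈W ; b∈W = b∈W ; c∈W = c∈W ; d∈W = d∈W
    ; a≢b = not-==⇒≢ a≠b ; a≢c = not-==⇒≢ a≠c ; a≢d = not-==⇒≢ a≠d
    ; b≢c = not-==⇒≢ b≠c ; b≢d = not-==⇒≢ b≠d ; c≢d = not-==⇒≢ c≠d
    ; ab∈E = ab∈E ; cd∈E = cd∈E ; ac∉E = not-injective ac∉E ; bd∉E = not-injective bd∉E }

Mat : ℕ → Set
Mat n = Vec (Vec Bool n) n

_≟ᴹ_ : ∀ {n} → DecidableEquality (Mat n)
_≟ᴹ_ = ≡-dec (≡-dec Bool._≟_)

entries : ∀ {n} → Mat n → Adj n
entries M u v = lookup (lookup M u) v

module _ {n : ℕ} where

  entries-toMatrix : ∀ (A : Adj n) u v → entries (toMatrix A) u v ≡ A u v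
  entries-toMatrix A u v rewrite lookup∘tabulate (λ u → tabulate (A u)) u = lookup∘tabulate (A u) v

  toMatrix-cong : ∀ {A B : Adj n} → (∀ u v → A u v ≡ B u v) → toMatrix A ≡ toMatrix B
  toMatrix-cong A≡B = tabulate-cong λ u → tabulate-cong (A≡B u)

  restrictᴹ : Subset n → Mat n → Mat n
  restrictᴹ S M = toMatrix (restrict S (entries M))

  toMatrix-injective : ∀ {A B : Adj n} → toMatrix A ≡ toMatrix B → ∀ u v → A u v ≡ B u v
  toMatrix-injective {A} {B} A≡B u v = begin
    A u v                      ≡⟨ entries-toMatrix A u v ⟨
    entries (toMatrix A) u v   ≡⟨ cong (λ M → entries M u v) A≡B ⟩
    entries (toMatrix B) u v   ≡⟨ entries-toMatrix B u v ⟩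
    B u v                      ∎
    where open ≡-Reasoning

module _ {n : ℕ} (A : Adj n) where

  switchResults : List (Quad n) → List (Mat n)
  switchResults qs = deduplicate _≟ᴹ_ (map (toMatrix ∘ switch A) qs)

  switchResults-mono : ∀ {qs qs′} → (∀ {q} → q ∈ qs → q ∈ qs′) → ∀ {M} → M ∈ switchResults qs → M ∈ switchResults qs′
  switchResults-mono {qs} qs⊆qs′ M∈ with ∈-map⁻ _ (∈-deduplicate⁻ _≟ᴹ_ (map _ qs) M∈)
  ... | q , q∈qs , refl = ∈-deduplicate⁺ _≟ᴹ_ (∈-map⁺ _ (qs⊆qs′ q∈qs))

  switchesWithin : Subset n → List (Quad n)
  switchesWithin S = filterᵇ (isSwitch S (restrict S A)) allQuads

  switchesWithin-sound : ∀ S {a b c d} → (a , b , c , d) ∈ switchesWithin S → IsTwoSwitch S (restrict S A) a b c d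
  switchesWithin-sound S q∈ = isSwitch-sound (proj₂ (∈-filterᵇ⁻ (isSwitch S (restrict S A)) {xs = allQuads} q∈))

  switchesWithin⊆switches : ∀ S {q} → q ∈ switchesWithin S → q ∈ filterᵇ (isSwitch full A) allQuads
  switchesWithin⊆switches S {q} q∈ =
    let q∈quads , sw = ∈-filterᵇ⁻ (isSwitch S (restrict S A)) {xs = allQuads} q∈
    in ∈-filterᵇ⁺ (isSwitch full A) q∈quads (isSwitch-restrict S A q sw)

  switchesWithin-restrict : ∀ {S q} → q ∈ switchesWithin S
                          → toMatrix (switch (restrict S A) q) ≡ restrictᴹ S (toMatrix (switch A q))
  switchesWithin-restrict {S} {a , b , c , d} q∈ = toMatrix-cong λ x y → begin
    switch (restrict S A) (a , b , c , d) x y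
      ≡⟨ switch-restrict S A a∈W b∈W c∈W d∈W x y ⟩
    restrict S (switch A (a , b , c , d)) x y
      ≡⟨ cong (λ z → lookup S x ∧ lookup S y ∧ z) (entries-toMatrix (switch A (a , b , c , d)) x y) ⟨
    restrict S (entries (toMatrix (switch A (a , b , c , d)))) x y ∎
    where
    open ≡-Reasoning
    open IsTwoSwitch (switchesWithin-sound S q∈)

  deg-restrict≤ : ∀ S → deg S (restrict S A) ≤ length (switchResults (switchesWithin S))
  deg-restrict≤ S = begin
    deg S (restrict S A)
      ≡⟨ cong (length ∘ deduplicate _≟ᴹ_) (map-cong-local {xs = Q} (All.tabulate (switchesWithin-restrict {S}))) ⟩
    length (deduplicate _≟ᴹ_ (map (restrictᴹ S ∘ toMatrix ∘ switch A) Q))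
      ≡⟨ cong (length ∘ deduplicate _≟ᴹ_) (map-∘ Q) ⟩
    length (deduplicate _≟ᴹ_ (map (restrictᴹ S) (map (toMatrix ∘ switch A) Q)))
      ≤⟨ length-deduplicate-map≤ _≟ᴹ_ _≟ᴹ_ (restrictᴹ S) (map (toMatrix ∘ switch A) Q) ⟩
    length (switchResults Q)
      ∎
    where
    open ℕ.≤-Reasoning
    Q = switchesWithin S

pairs : ∀ n → List (Fin n × Fin n)
pairs n = concatMap (λ u → map (λ v → (u , v)) (allFin n)) (allFin n)

∈-pairs : ∀ {n} (u v : Fin n) → (u , v) ∈ pairs n
∈-pairs {n} u v = ∈-concatMap⁺ _ (Any.map (λ { refl → ∈-map⁺ (u ,_) (∈-allFin v) }) (∈-allFin u))

module _ {n : ℕ} (G : Graph n) where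

  isCommonEdge : Subset n → Subset n → Fin n × Fin n → Bool
  isCommonEdge S T (u , v) = (toℕ u <ᵇ toℕ v) ∧ inducedAdj G S u v ∧ inducedAdj G T u v

  inducedAdj-intro : ∀ S {u v} → lookup S u ≡ true → lookup S v ≡ true → adj G u v ≡ true → inducedAdj G S u v ≡ true
  inducedAdj-intro S Su Sv uv∈E rewrite Su | Sv = uv∈E

  inducedAdj⇒adj : ∀ {S u v} → inducedAdj G S u v ≡ true → adj G u v ≡ true
  inducedAdj⇒adj {S} {u} uv∈E = proj₂ (∧-true (proj₂ (∧-true {lookup S u} uv∈E)))

  inducedAdj-sym : ∀ S u v → inducedAdj G S u v ≡ inducedAdj G S v u
  inducedAdj-sym S u v rewrite Graph.sym G u v with lookup S u | lookup S v
  ... | true  | true  = refl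
  ... | true  | false = refl
  ... | false | true  = refl
  ... | false | false = refl

  inducedAdj⇒≢ : ∀ {S u v} → inducedAdj G S u v ≡ true → u ≢ v
  inducedAdj⇒≢ {S} uv∈E refl with () ← trans (sym (inducedAdj⇒adj {S} uv∈E)) (irrefl G _)

  isCommonEdge-intro : ∀ {S T u v} → toℕ u < toℕ v → inducedAdj G S u v ≡ true → inducedAdj G T u v ≡ true
                     → isCommonEdge S T (u , v) ≡ true
  isCommonEdge-intro u<v Suv Tuv rewrite Equivalence.to T-≡ (ℕ.<⇒<ᵇ u<v) | Suv | Tuv = refl

  orient-commonEdge : ∀ {S T a b} → inducedAdj G S a b ≡ true → inducedAdj G T a b ≡ true
         → ∃ λ e → (e ≡ (a , b) ⊎ e ≡ (b , a)) × isCommonEdge S T e ≡ true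
  orient-commonEdge {S} {T} {a} {b} Sab Tab with ℕ.<-cmp (toℕ a) (toℕ b)
  ... | tri< a<b _ _ = (a , b) , inj₁ refl , isCommonEdge-intro {S} {T} a<b Sab Tab
  ... | tri≈ _ a≡b _ with () ← inducedAdj⇒≢ {S} Sab (toℕ-injective a≡b)
  ... | tri> _ _ b<a = (b , a) , inj₂ refl ,
    isCommonEdge-intro {S} {T} b<a (trans (inducedAdj-sym S b a) Sab) (trans (inducedAdj-sym T b a) Tab)

  2≤commonEdges : ∀ {S T a b c d} → inducedAdj G S a b ≡ true → inducedAdj G T a b ≡ true
                → inducedAdj G S c d ≡ true → inducedAdj G T c d ≡ true → a ≢ c → a ≢ d
                → 2 ≤ commonEdges G S T
  2≤commonEdges {S} {T} Sab Tab Scd Tcd a≢c a≢d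
    with (u₁ , v₁) , e₁≈ab , e₁∈ ← orient-commonEdge {S} {T} Sab Tab
       | (u₂ , v₂) , e₂≈cd , e₂∈ ← orient-commonEdge {S} {T} Scd Tcd
    = 2≤length-filterᵇ (isCommonEdge S T) (∈-pairs u₁ v₁) (∈-pairs u₂ v₂)
        (λ e₁≡e₂ → [ a≢c , a≢d ] (shared-endpoint e₁≈ab (subst _ (sym e₁≡e₂) e₂≈cd))) e₁∈ e₂∈
    where
    shared-endpoint : ∀ {a b c d} {e : Fin n × Fin n} → (e ≡ (a , b) ⊎ e ≡ (b , a)) → (e ≡ (c , d) ⊎ e ≡ (d , c))
                    → a ≡ c ⊎ a ≡ d
    shared-endpoint (inj₁ refl) (inj₁ eq) = inj₁ (cong proj₁ eq)
    shared-endpoint (inj₁ refl) (inj₂ eq) = inj₂ (cong proj₁ eq)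
    shared-endpoint (inj₂ refl) (inj₁ eq) = inj₂ (cong proj₂ eq)
    shared-endpoint (inj₂ refl) (inj₂ eq) = inj₁ (cong proj₂ eq)

  -- The edges ab and cd removed by q are missing from the common result, so q′ removes
  -- them as well; hence they lie in T, and they are two common edges of G[S] and G[T].
  sameResult⇒2≤commonEdges : ∀ {S T q q′} → q ∈ switchesWithin (adj G) S → q′ ∈ switchesWithin (adj G) T
    → toMatrix (switch (adj G) q) ≡ toMatrix (switch (adj G) q′) → 2 ≤ commonEdges G S T
  sameResult⇒2≤commonEdges {S} {T} {a , b , c , d} {_ , _ , _ , _} q∈ q′∈ same =
    2≤commonEdges {S} {T} ab∈E (lost⇒∈T (switch-removes-ab (adj G) a b c d) (inducedAdj⇒adj {S} ab∈E))
                          cd∈E (lost⇒∈T (switch-removes-cd (adj G) a b c d) (inducedAdj⇒adj {S} cd∈E))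
                          a≢c a≢d
    where
    open IsTwoSwitch (switchesWithin-sound (adj G) S q∈)
    module q′ = IsTwoSwitch (switchesWithin-sound (adj G) T q′∈)
    lost⇒∈T : ∀ {x y} → switch (adj G) (a , b , c , d) x y ≡ false → adj G x y ≡ true → inducedAdj G T x y ≡ true
    lost⇒∈T {x} {y} lost xy∈E =
      let lost′ = trans (sym (toMatrix-injective same x y)) lost
          x∈T , y∈T = samePair₂-∈ (λ v → lookup T v ≡ true) {x} {y} (switch-lost-edge (adj G) lost′ xy∈E)
                        q′.a∈W q′.b∈W q′.c∈W q′.d∈W
      in inducedAdj-intro T x∈T y∈T xy∈E

  switchResults-disjoint : ∀ S T → commonEdges G S T ≤ 1
    → Disjoint (switchResults (adj G) (switchesWithin (adj G) S)) (switchResults (adj G) (switchesWithin (adj G) T))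
  switchResults-disjoint S T common≤1 (M∈S , M∈T)
    with q , q∈ , refl ← ∈-map⁻ _ (∈-deduplicate⁻ _≟ᴹ_ _ M∈S)
       | q′ , q′∈ , same ← ∈-map⁻ _ (∈-deduplicate⁻ _≟ᴹ_ _ M∈T)
    = ℕ.≤⇒≯ common≤1 (sameResult⇒2≤commonEdges {S} {T} q∈ q′∈ same)

mainTheorem16 : ∀ {n k} (G : Graph n) (H : Fin k → Subset n)
                → (∀ i j → i ≢ j → commonEdges G (H i) (H j) ≤ 1)
                → sumFin (λ i → degInduced G (H i)) ≤ degG G
mainTheorem16 {n} {k} G H commonEdges≤1 = begin
  sumFin (λ i → degInduced G (H i))
    ≤⟨ sum-map-mono-≤ (λ i → deg-restrict≤ (adj G) (H i)) (allFin k) ⟩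
  sum (map (length ∘ results) (allFin k))
    ≤⟨ sum-length≤length-of-disjoint results (Unique.allFin⁺ k) (λ i → UniqueDec.deduplicate-! _≟ᴹ_ _)
         (λ i≢j → switchResults-disjoint G (H _) (H _) (commonEdges≤1 _ _ i≢j))
         (switchResults-mono (adj G) (switchesWithin⊆switches (adj G) (H _))) ⟩
  degG G
    ∎
  where
  open ℕ.≤-Reasoning
  results : Fin k → List (Mat n)
  results i = switchResults (adj G) (switchesWithin (adj G) (H i))
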